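{- For every integer $k\ge 4$, $Z_1\le C_k$.
   Context: All graphs are finite and simple, considered up to isomorphism. An edge-colored graph is a pair $(G,c)$ with $c\colon E(G)\to\mathbb{N}$ an arbitrary map (not necessarily proper); it is colored in $t$ or more colors if $|c(E(G))|\ge t$. A subgraph (not necessarily induced) is rainbow if its edges receive pairwise distinct colors. $(G,c)$ is rainbow $H$-free if $G$ contains no rainbow subgraph isomorphic to $H$. For graphs $H_1,H_2$, write $H_1\le H_2$ if there is a positive integer $t$ such that every rainbow $H_1$-free edge-colored complete graph colored in $t$ or more colors is rainbow $H_2$-free. $C_k$ is the cycle on $k$ vertices. $Z_1$ is the graph obtained from the triangle $C_3$ by attaching one pendant edge (i.e., a triangle plus a new vertex adjacent to exactly one triangle vertex). -}

module Defs where

open import Data.Nat using (ℕ; suc; _≤_)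
open import Data.Fin using (Fin; zero; suc; fromℕ; inject₁)
open import Data.List using (List; _∷_; []; length; lookup; map; allFin)
open import Data.Product using (Σ; ∃; _×_; _,_; proj₁; proj₂)
open import Relation.Binary.PropositionalEquality using (_≡_; _≢_)
open import Relation.Nullary using (¬_)
open import Function.Definitions using (Injective)

-- A (finite simple) graph given by its number of vertices and an edge list
-- (each edge listed once, endpoints distinct).
record Graph : Set where
  field
    size  : ℕ
    edges : List (Fin size × Fin size)
open Graph public

-- An edge-coloring of the complete graph K_n on vertex set Fin n:
-- a symmetric map; the values on the diagonal are irrelevant.
Coloring : ℕ → Set
Coloring n = Fin n → Fin n → ℕ

Symmetric : ∀ {n} → Coloring n → Set
Symmetric {n} c = ∀ (i j : Fin n) → c i j ≡ c j i

-- |c(E(K_n))| ≥ t : there are t edges of K_n with pairwise distinct colors.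
ColoredInAtLeast : ∀ {n} → Coloring n → ℕ → Set
ColoredInAtLeast {n} c t =
  Σ (Fin t → Fin n × Fin n) λ e →
    (∀ i → proj₁ (e i) ≢ proj₂ (e i)) ×
    (∀ i j → c (proj₁ (e i)) (proj₂ (e i)) ≡ c (proj₁ (e j)) (proj₂ (e j)) → i ≡ j)

RainbowCopy : (H : Graph) → ∀ {n} → Coloring n → Set
RainbowCopy H {n} c =
  Σ (Fin (size H) → Fin n) λ f →
    Injective _≡_ _≡_ f ×
    (∀ (p q : Fin (length (edges H))) →
       c (f (proj₁ (lookup (edges H) p))) (f (proj₂ (lookup (edges H) p)))
       ≡ c (f (proj₁ (lookup (edges H) q))) (f (proj₂ (lookup (edges H) q)))
       → p ≡ q)

RainbowFree : (H : Graph) → ∀ {n} → Coloring n → Set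
RainbowFree H c = ¬ RainbowCopy H c

_≼_ : Graph → Graph → Set
H₁ ≼ H₂ = ∃ λ (t : ℕ) → 1 ≤ t ×
  (∀ (n : ℕ) (c : Coloring n) → Symmetric c → ColoredInAtLeast c t →
     RainbowFree H₁ c → RainbowFree H₂ c)

-- Cycle C_k for k = suc m (meaningful for k ≥ 3): edges {i,i+1} and {m,0}.
C : ℕ → Graph
C 0 = record { size = 0 ; edges = [] }
C (suc m) = record
  { size = suc m
  ; edges = (fromℕ m , zero) ∷ map (λ i → inject₁ i , suc i) (allFin m) }

Z₁ : Graph
Z₁ = record
  { size = 4
  ; edges = (zero , suc zero) ∷ (suc zero , suc (suc zero)) ∷ (suc (suc zero) , zero)
          ∷ (zero , suc (suc (suc zero))) ∷ [] }

{-# OPTIONS --safe #-}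
module Submission where

-- If the colouring has no rainbow Z₁, then in any rainbow path e′ a b d e the
-- chord ad repeats the colour of ab or of bd: otherwise abd is a rainbow
-- triangle, and of the two pendant edges de and e′a (coloured differently)
-- one differs from ad and completes a rainbow Z₁.  In a rainbow cycle of
-- length k ≥ 5 the shortcut v₀v₂ therefore gives a rainbow cycle of length
-- k − 1, and in a rainbow 4-cycle the diagonal v₀v₂ would need a colour of
-- v₀v₁ or v₁v₂ and also one of v₂v₃ or v₃v₀.  No lower bound on the number
-- of colours is needed, so t = 1.

open import Defs
open import Data.Nat using (ℕ; zero; suc; _≤_; _+_; s≤s; _≟_)
open import Data.Nat.Properties using (≤-refl)
open import Data.Fin as Fin using (Fin; zero; suc; fromℕ; inject₁; punchIn)
open import Data.Fin.Patterns using (0F; 1F; 2F; 3F)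
open import Data.Fin.Properties using (punchIn-injective)
open import Data.List using (List; _∷_; []; lookup; map)
open import Data.List.Membership.Propositional using (_∈_)
open import Data.List.Membership.Propositional.Properties using (∈-map⁺; ∈-allFin; ∈-lookup)
open import Data.List.Relation.Unary.All as All using (_∷_; [])
open import Data.List.Relation.Unary.AllPairs using (_∷_; [])
open import Data.List.Relation.Unary.Any using (here; there; index)
open import Data.List.Relation.Unary.Any.Properties using (lookup-index)
open import Data.List.Relation.Unary.Unique.Propositional using (Unique)
import Data.List.Relation.Unary.Unique.Propositional.Properties as Unique
import Data.List.Relation.Unary.Unique.DecPropositional as UniqueDec
open import Data.Product using (_×_; _,_; proj₁; proj₂)
open import Data.Sum using (_⊎_; inj₁; inj₂)
open import Data.Empty using (⊥; ⊥-elim)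
open import Function using (_∘_; id)
open import Function.Definitions using (Injective)
open import Relation.Binary.PropositionalEquality
  using (_≡_; _≢_; _≗_; refl; sym; trans; cong; subst₂; ≢-sym; module ≡-Reasoning)
open import Relation.Nullary using (¬_; yes; no)
open import Relation.Nullary.Decidable using (True; toWitness)

map-lookup-injective : ∀ {A B : Set} (g : A → B) {xs : List A} →
                       Unique (map g xs) → Injective _≡_ _≡_ (g ∘ lookup xs)
map-lookup-injective g {_ ∷ _}  (_ ∷ _)      {zero}  {zero}  _  = refl
map-lookup-injective g {_ ∷ _}  (gx∉ ∷ _)    {zero}  {suc j} eq =
  ⊥-elim (All.lookup gx∉ (∈-map⁺ g (∈-lookup j)) eq)
map-lookup-injective g {_ ∷ _}  (gx∉ ∷ _)    {suc i} {zero}  eq =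
  ⊥-elim (All.lookup gx∉ (∈-map⁺ g (∈-lookup i)) (sym eq))
map-lookup-injective g {_ ∷ _}  (_ ∷ unique) {suc i} {suc j} eq =
  cong suc (map-lookup-injective g unique eq)

-- Edge i of a cycle joins vertex i − 1 to vertex i (cyclically), so edge 0 is
-- the closing edge, as in the edge list of C.
cyclicPred : ∀ {k} → Fin k → Fin k
cyclicPred {suc m} zero    = fromℕ m
cyclicPred         (suc i) = inject₁ i

∈-edges-C : ∀ {m} (i : Fin (suc m)) → (cyclicPred i , i) ∈ edges (C (suc m))
∈-edges-C zero    = here refl
∈-edges-C (suc i) = there (∈-map⁺ _ (∈-allFin i))

module _ {n : ℕ} (c : Coloring n) where

  edgeColour : ∀ {k} → (Fin k → Fin n) → Fin k × Fin k → ℕ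
  edgeColour f e = c (f (proj₁ e)) (f (proj₂ e))

  rainbowCopy-edges : ∀ {H} ((f , _ , _) : RainbowCopy H c) {e e′} →
                      e ∈ edges H → e′ ∈ edges H →
                      edgeColour f e ≡ edgeColour f e′ → e ≡ e′
  rainbowCopy-edges {H} (f , _ , rainbow) {e} {e′} e∈ e′∈ eq = begin
    e                            ≡⟨ lookup-index e∈ ⟩
    lookup (edges H) (index e∈)  ≡⟨ cong (lookup (edges H)) (rainbow _ _ lookups-eq) ⟩
    lookup (edges H) (index e′∈) ≡⟨ sym (lookup-index e′∈) ⟩
    e′                           ∎
    where
    open ≡-Reasoning
    lookups-eq : edgeColour f (lookup (edges H) (index e∈)) ≡
                 edgeColour f (lookup (edges H) (index e′∈))
    lookups-eq = subst₂ (λ u u′ → edgeColour f u ≡ edgeColour f u′)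
                        (lookup-index e∈) (lookup-index e′∈) eq

  rainbowZ₁ : ∀ {x y z w} → Unique (x ∷ y ∷ z ∷ w ∷ []) →
              Unique (c x y ∷ c y z ∷ c z x ∷ c x w ∷ []) → RainbowCopy Z₁ c
  rainbowZ₁ {x} {y} {z} {w} distinct rainbow =
    lookup vertices ,
    map-lookup-injective id distinct ,
    λ _ _ → map-lookup-injective (edgeColour (lookup vertices)) rainbow
    where
    vertices : List (Fin n)
    vertices = x ∷ y ∷ z ∷ w ∷ []

  cycleColour : ∀ {k} → (Fin k → Fin n) → Fin k → ℕ
  cycleColour v i = c (v (cyclicPred i)) (v i)

  record RainbowCycle (k : ℕ) : Set where
    field
      vertex           : Fin k → Fin n
      vertex-injective : Injective _≡_ _≡_ vertex
      colour-injective : Injective _≡_ _≡_ (cycleColour vertex)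

  rainbowCopy⇒rainbowCycle : ∀ {m} → RainbowCopy (C (suc m)) c → RainbowCycle (suc m)
  rainbowCopy⇒rainbowCycle copy@(f , f-injective , _) = record
    { vertex           = f
    ; vertex-injective = f-injective
    ; colour-injective = λ {i} {j} eq →
        cong proj₂ (rainbowCopy-edges copy (∈-edges-C i) (∈-edges-C j) eq)
    }

  skip-vertex : ∀ {k} (cycle : RainbowCycle (suc k)) (i p : Fin (suc k)) →
                let open RainbowCycle cycle in
                cycleColour (vertex ∘ punchIn i) ≗ cycleColour vertex ∘ punchIn p →
                RainbowCycle k
  skip-vertex cycle i p colours = record
    { vertex           = vertex ∘ punchIn i
    ; vertex-injective = punchIn-injective i _ _ ∘ vertex-injective
    ; colour-injective = λ eq → punchIn-injective p _ _
        (colour-injective (trans (sym (colours _)) (trans eq (colours _))))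
    }
    where open RainbowCycle cycle

  module _ {k} (cycle : RainbowCycle k) where
    open RainbowCycle cycle

    distinct-vertices : (is : List (Fin k)) → {True (UniqueDec.unique? Fin._≟_ is)} →
                        Unique (map vertex is)
    distinct-vertices is {distinct} = Unique.map⁺ vertex-injective (toWitness distinct)

    distinct-colours : (is : List (Fin k)) → {True (UniqueDec.unique? Fin._≟_ is)} →
                       Unique (map (cycleColour vertex) is)
    distinct-colours is {distinct} = Unique.map⁺ colour-injective (toWitness distinct)

module _ {n : ℕ} {c : Coloring n} (c-sym : Symmetric c) (Z₁-free : RainbowFree Z₁ c) where

  chord-colour : ∀ {e′ a b d e} →
                 Unique (a ∷ b ∷ d ∷ e′ ∷ []) → Unique (d ∷ a ∷ b ∷ e ∷ []) →
                 Unique (c e′ a ∷ c a b ∷ c b d ∷ c d e ∷ []) →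
                 c a d ≡ c a b ⊎ c a d ≡ c b d
  chord-colour {e′} {a} {b} {d} {e} distinct-a distinct-d
    ((e′a≢ab ∷ e′a≢bd ∷ e′a≢de ∷ []) ∷ (ab≢bd ∷ ab≢de ∷ []) ∷ (bd≢de ∷ []) ∷ [] ∷ [])
    with c a d ≟ c a b | c a d ≟ c b d
  ... | yes ad≡ab | _         = inj₁ ad≡ab
  ... | no _      | yes ad≡bd = inj₂ ad≡bd
  ... | no ad≢ab  | no ad≢bd  with c d a ≟ c d e
  ...   | no da≢de = ⊥-elim (Z₁-free (rainbowZ₁ c distinct-d
            ((da≢ab ∷ da≢bd ∷ da≢de ∷ []) ∷ (ab≢bd ∷ ab≢de ∷ []) ∷ (bd≢de ∷ []) ∷ [] ∷ [])))
    where
    da≢ab : c d a ≢ c a b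
    da≢ab = ad≢ab ∘ trans (c-sym a d)
    da≢bd : c d a ≢ c b d
    da≢bd = ad≢bd ∘ trans (c-sym a d)
  ...   | yes da≡de = ⊥-elim (Z₁-free (rainbowZ₁ c distinct-a
            (subst₂ (λ da ae′ → Unique (c a b ∷ c b d ∷ da ∷ ae′ ∷ [])) (c-sym a d) (c-sym e′ a)
              ((ab≢bd ∷ ≢-sym ad≢ab ∷ ≢-sym e′a≢ab ∷ []) ∷ (≢-sym ad≢bd ∷ ≢-sym e′a≢bd ∷ []) ∷
               (ad≢e′a ∷ []) ∷ [] ∷ []))))
    where
    ad≢e′a : c a d ≢ c e′ a
    ad≢e′a ad≡e′a = e′a≢de (trans (sym ad≡e′a) (trans (c-sym a d) da≡de))

  no-rainbow-C₄ : ¬ RainbowCycle c 4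
  no-rainbow-C₄ cycle =
    chords-disjoint
      (chord-colour (distinct-vertices c cycle (0F ∷ 1F ∷ 2F ∷ 3F ∷ []))
                    (distinct-vertices c cycle (2F ∷ 0F ∷ 1F ∷ 3F ∷ []))
                    (distinct-colours  c cycle (0F ∷ 1F ∷ 2F ∷ 3F ∷ [])))
      (chord-colour (distinct-vertices c cycle (2F ∷ 3F ∷ 0F ∷ 1F ∷ []))
                    (distinct-vertices c cycle (0F ∷ 2F ∷ 3F ∷ 1F ∷ []))
                    (distinct-colours  c cycle (2F ∷ 3F ∷ 0F ∷ 1F ∷ [])))
    where
    open RainbowCycle cycle
    colour : Fin 4 → ℕ
    colour = cycleColour c vertex
    chords-disjoint : c (vertex 0F) (vertex 2F) ≡ colour 1F ⊎ c (vertex 0F) (vertex 2F) ≡ colour 2F →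
                      c (vertex 2F) (vertex 0F) ≡ colour 3F ⊎ c (vertex 2F) (vertex 0F) ≡ colour 0F →
                      ⊥
    chords-disjoint (inj₁ p) (inj₁ q) with () ← colour-injective (trans (sym p) (trans (c-sym _ _) q))
    chords-disjoint (inj₁ p) (inj₂ q) with () ← colour-injective (trans (sym p) (trans (c-sym _ _) q))
    chords-disjoint (inj₂ p) (inj₁ q) with () ← colour-injective (trans (sym p) (trans (c-sym _ _) q))
    chords-disjoint (inj₂ p) (inj₂ q) with () ← colour-injective (trans (sym p) (trans (c-sym _ _) q))

  -- The shortcut v₀v₂ repeats the colour of edge 1 or edge 2; the colour of the
  -- other one is the colour that disappears from the cycle.
  shorten : ∀ {j} → RainbowCycle c (5 + j) → RainbowCycle c (4 + j)
  shorten {j} cycle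
    with chord-colour (distinct-vertices c cycle (0F ∷ 1F ∷ 2F ∷ fromℕ (4 + j) ∷ []))
                      (distinct-vertices c cycle (2F ∷ 0F ∷ 1F ∷ 3F ∷ []))
                      (distinct-colours  c cycle (0F ∷ 1F ∷ 2F ∷ 3F ∷ []))
  ... | inj₁ chord≡colour₁ =
    skip-vertex c cycle 1F 2F λ { 0F → refl ; 1F → chord≡colour₁ ; (suc (suc _)) → refl }
  ... | inj₂ chord≡colour₂ =
    skip-vertex c cycle 1F 1F λ { 0F → refl ; 1F → chord≡colour₂ ; (suc (suc _)) → refl }

  no-rainbow-cycle : ∀ j → ¬ RainbowCycle c (4 + j)
  no-rainbow-cycle zero    = no-rainbow-C₄
  no-rainbow-cycle (suc j) = no-rainbow-cycle j ∘ shorten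

theorem5 : ∀ (k : ℕ) → 4 ≤ k → Z₁ ≼ C k
theorem5 (suc (suc (suc (suc j)))) (s≤s (s≤s (s≤s (s≤s _)))) =
  1 , ≤-refl , λ n c c-sym _ Z₁-free →
    no-rainbow-cycle c-sym Z₁-free j ∘ rainbowCopy⇒rainbowCycle c
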